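{- Let $G$ be a factored graph and let $(u,v)\in E(G)$ be an edge. Then $u$ and $v$ belong to the same factored component of $G$ (i.e., there is a factored component $G_F$ of $G$ containing both $u$ and $v$).
   Context: All graphs are directed. Graph operations: Cartesian product $G\,\square\,H$ (vertex set $V(G)\times V(H)$, edge $((v_1,u_1),(v_2,u_2))$ iff $v_1=v_2$ and $(u_1,u_2)\in E(H)$, or $u_1=u_2$ and $(v_1,v_2)\in E(G)$), tensor product $G\times H$ (vertex set $V(G)\times V(H)$, edge iff $(v_1,v_2)\in E(G)$ and $(u_1,u_2)\in E(H)$), and union $G\cup H$ (vertex set $V(G)\cup V(H)$, edge set $E(G)\cup E(H)$). Vertices of products are flattened tuples, so products are associative. A factored graph $G=f(G_1,\dots,G_m)$ is given by a formula $f$ built from input graphs using these operations and parentheses. Its tree structure is defined recursively: if $f$ is a single graph, the tree is a single leaf; if $f=H_1\circ\cdots\circ H_\ell$ for an operation $\circ\in\{\cup,\square,\times\}$, the root is labelled $\circ$ with $\ell$ children, the $i$-th being the tree structure of $H_i$. A factored component of $G$ is a factored graph whose tree structure is obtained from that of $G$ by recursively replacing each internal union node with the subtree rooted at one of its children. -}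

module Defs where

open import Level using (0ℓ)
open import Data.Nat using (ℕ)
open import Data.Fin using (Fin)
open import Data.List using (List; []; _∷_; [_]; _++_)
open import Data.List.NonEmpty using (List⁺; _∷_; toList)
open import Data.List.Relation.Unary.Any using (Any)
open import Data.List.Relation.Binary.Pointwise using (Pointwise)
open import Data.Product using (Σ; ∃; _×_; _,_)
open import Data.Sum using (_⊎_)
open import Relation.Binary.PropositionalEquality using (_≡_)

record Graph (X : Set) : Set₁ where
  field
    V : X → Set
    E : X → X → Set
open Graph public

WellFormed : {X : Set} → Graph X → Set
WellFormed {X} G = ∀ (a b : X) → E G a b → V G a × V G b

module _ {A : Set} where

  -- Vertices of factored graphs are flattened tuples = lists of atoms.
  Vtx : Set
  Vtx = List A

  -- The input graph (vertices are atoms) seen as a graph on 1-tuples.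
  lift : Graph A → Graph Vtx
  V (lift G) w = Σ A λ a → (w ≡ [ a ]) × V G a
  E (lift G) w₁ w₂ = Σ A λ a → Σ A λ b → (w₁ ≡ [ a ]) × (w₂ ≡ [ b ]) × E G a b

  _∪ᴳ_ : Graph Vtx → Graph Vtx → Graph Vtx
  V (G ∪ᴳ H) w = V G w ⊎ V H w
  E (G ∪ᴳ H) w₁ w₂ = E G w₁ w₂ ⊎ E H w₁ w₂

  _□ᴳ_ : Graph Vtx → Graph Vtx → Graph Vtx
  V (G □ᴳ H) w = Σ Vtx λ x → Σ Vtx λ y → (w ≡ x ++ y) × V G x × V H y
  E (G □ᴳ H) w₁ w₂ =
    Σ Vtx λ x₁ → Σ Vtx λ y₁ → Σ Vtx λ x₂ → Σ Vtx λ y₂ →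
      (w₁ ≡ x₁ ++ y₁) × (w₂ ≡ x₂ ++ y₂) ×
      (((x₁ ≡ x₂) × V G x₁ × E H y₁ y₂) ⊎ ((y₁ ≡ y₂) × V H y₁ × E G x₁ x₂))

  _×ᴳ_ : Graph Vtx → Graph Vtx → Graph Vtx
  V (G ×ᴳ H) w = Σ Vtx λ x → Σ Vtx λ y → (w ≡ x ++ y) × V G x × V H y
  E (G ×ᴳ H) w₁ w₂ =
    Σ Vtx λ x₁ → Σ Vtx λ y₁ → Σ Vtx λ x₂ → Σ Vtx λ y₂ →
      (w₁ ≡ x₁ ++ y₁) × (w₂ ≡ x₂ ++ y₂) × E G x₁ x₂ × E H y₁ y₂

data Op : Set where
  ∪op □op ×op : Op

-- Formulas over m input graphs; an internal node H₁ ∘ ⋯ ∘ Hℓ has a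
-- nonempty list of children (its tree structure is the formula itself).
data Formula (m : ℕ) : Set where
  leaf : Fin m → Formula m
  node : Op → List⁺ (Formula m) → Formula m

module _ {A : Set} where

  opᴳ : Op → Graph (Vtx {A}) → Graph (Vtx {A}) → Graph (Vtx {A})
  opᴳ ∪op = _∪ᴳ_
  opᴳ □op = _□ᴳ_
  opᴳ ×op = _×ᴳ_

  module Semantics {m : ℕ} (Gs : Fin m → Graph A) where
    mutual
      ⟦_⟧ : Formula m → Graph (Vtx {A})
      ⟦ leaf i ⟧ = lift (Gs i)
      ⟦ node o (f ∷ fs) ⟧ = fold o ⟦ f ⟧ fs

      -- H₁ ∘ (H₂ ∘ (⋯ ∘ Hℓ)); by flattening this is H₁ ∘ ⋯ ∘ Hℓ.
      fold : Op → Graph (Vtx {A}) → List (Formula m) → Graph (Vtx {A})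
      fold o G [] = G
      fold o G (h ∷ hs) = opᴳ o G (fold o ⟦ h ⟧ hs)

-- c ≼ f : the tree c is a factored component of the tree f, i.e. it is
-- obtained by recursively replacing every union node of f by (the
-- component of) one of its children.
data _≼_ {m : ℕ} : Formula m → Formula m → Set where
  leaf≼ : ∀ i → leaf i ≼ leaf i
  ∪≼ : ∀ {c fs} → Any (c ≼_) (toList fs) → c ≼ node ∪op fs
  □≼ : ∀ {cs fs} → Pointwise _≼_ (toList cs) (toList fs) → node □op cs ≼ node □op fs
  ×≼ : ∀ {cs fs} → Pointwise _≼_ (toList cs) (toList fs) → node ×op cs ≼ node ×op fs

{-# OPTIONS --safe #-}
module Submission where

open import Defs
open import Data.Nat using (ℕ)
open import Data.Fin using (Fin)
open import Data.Product using (Σ; _×_; _,_)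
open import Data.Sum using (_⊎_; inj₁; inj₂)
open import Data.List using (List; []; _∷_; _++_)
open import Data.List.NonEmpty using (List⁺; _∷_; toList)
open import Data.List.Relation.Unary.Any using (Any; here; there)
open import Data.List.Relation.Binary.Pointwise using (Pointwise; []; _∷_)
open import Relation.Binary.PropositionalEquality using (refl)

-- An edge of a union is an edge of one child, and an
-- edge of a product splits into one edge per factor -- except that in a Cartesian
-- product all but one of these "edges" are a vertex staying put. So we prove the
-- stronger claim for E⁼, edges together with loops at vertices: its instances in a
-- product split into instances in the factors, and the components found for the
-- factors assemble, as a product, into one component containing both endpoints.

data E⁼ {X : Set} (G : Graph X) : X → X → Set where
  loop : ∀ {u} → V G u → E⁼ G u u
  edge : ∀ {u v} → E G u v → E⁼ G u v

E⁼-endpoints : {X : Set} {G : Graph X} → WellFormed G →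
  ∀ {u v} → E⁼ G u v → V G u × V G v
E⁼-endpoints _  (loop p) = p , p
E⁼-endpoints wf (edge e) = wf _ _ e

data IsProduct : Op → Set where
  cartesian : IsProduct □op
  tensor    : IsProduct ×op

module _ {A : Set} where

  lift-wellFormed : {G : Graph A} → WellFormed G → WellFormed (lift G)
  lift-wellFormed wf _ _ (a , b , refl , refl , e) with wf a b e
  ... | va , vb = (a , refl , va) , (b , refl , vb)

  E⁼-∪ : (G H : Graph (Vtx {A})) {u v : Vtx {A}} →
    E⁼ (G ∪ᴳ H) u v → E⁼ G u v ⊎ E⁼ H u v
  E⁼-∪ _ _ (loop (inj₁ p)) = inj₁ (loop p)
  E⁼-∪ _ _ (loop (inj₂ p)) = inj₂ (loop p)
  E⁼-∪ _ _ (edge (inj₁ e)) = inj₁ (edge e)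
  E⁼-∪ _ _ (edge (inj₂ e)) = inj₂ (edge e)

  data _⊗_ (R S : Vtx {A} → Vtx {A} → Set) : Vtx {A} → Vtx {A} → Set where
    concat : ∀ {x₁ x₂ y₁ y₂} → R x₁ x₂ → S y₁ y₂ → (R ⊗ S) (x₁ ++ y₁) (x₂ ++ y₂)

  V-product : ∀ {o} {G H : Graph (Vtx {A})} {x y} → IsProduct o →
    V G x → V H y → V (opᴳ o G H) (x ++ y)
  V-product cartesian p q = _ , _ , refl , p , q
  V-product tensor    p q = _ , _ , refl , p , q

  E⁼-product : ∀ {o} → IsProduct o → (G H : Graph (Vtx {A})) {u v : Vtx {A}} →
    E⁼ (opᴳ o G H) u v → (E⁼ G ⊗ E⁼ H) u v
  E⁼-product cartesian _ _ (loop (_ , _ , refl , p , q)) = concat (loop p) (loop q)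
  E⁼-product tensor    _ _ (loop (_ , _ , refl , p , q)) = concat (loop p) (loop q)
  E⁼-product cartesian _ _ (edge (_ , _ , _ , _ , refl , refl , inj₁ (refl , p , e))) = concat (loop p) (edge e)
  E⁼-product cartesian _ _ (edge (_ , _ , _ , _ , refl , refl , inj₂ (refl , q , e))) = concat (edge e) (loop q)
  E⁼-product tensor    _ _ (edge (_ , _ , _ , _ , refl , refl , e , e′)) = concat (edge e) (edge e′)

module _ {A : Set} {m : ℕ} (Gs : Fin m → Graph A) (wf : ∀ i → WellFormed (Gs i)) where
  open Semantics Gs

  InComponent : Formula m → Vtx {A} → Vtx {A} → Set
  InComponent f u v = Σ (Formula m) λ c → (c ≼ f) × V ⟦ c ⟧ u × V ⟦ c ⟧ v

  InSomeComponent : List (Formula m) → Vtx {A} → Vtx {A} → Set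
  InSomeComponent fs u v = Σ (Formula m) λ c → Any (c ≼_) fs × V ⟦ c ⟧ u × V ⟦ c ⟧ v

  InComponentwise : Op → List⁺ (Formula m) → Vtx {A} → Vtx {A} → Set
  InComponentwise o fs u v = Σ (List⁺ (Formula m)) λ cs →
    Pointwise _≼_ (toList cs) (toList fs) × V ⟦ node o cs ⟧ u × V ⟦ node o cs ⟧ v

  mutual
    E⁼-inComponent : ∀ f {u v : Vtx {A}} → E⁼ ⟦ f ⟧ u v → InComponent f u v
    E⁼-inComponent (leaf i) r = leaf i , leaf≼ i , E⁼-endpoints (lift-wellFormed (wf i)) r
    E⁼-inComponent (node ∪op (f ∷ fs)) r with E⁼-fold-∪ f fs r
    ... | c , c≼ , p , q = c , ∪≼ c≼ , p , q
    E⁼-inComponent (node □op (f ∷ fs)) r with E⁼-fold-product cartesian f fs r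
    ... | cs , cs≼ , p , q = node □op cs , □≼ cs≼ , p , q
    E⁼-inComponent (node ×op (f ∷ fs)) r with E⁼-fold-product tensor f fs r
    ... | cs , cs≼ , p , q = node ×op cs , ×≼ cs≼ , p , q

    E⁼-fold-∪ : ∀ f fs {u v : Vtx {A}} → E⁼ (fold ∪op ⟦ f ⟧ fs) u v → InSomeComponent (f ∷ fs) u v
    E⁼-fold-∪ f [] r with E⁼-inComponent f r
    ... | c , c≼ , p , q = c , here c≼ , p , q
    E⁼-fold-∪ f (h ∷ hs) r with E⁼-∪ ⟦ f ⟧ (fold ∪op ⟦ h ⟧ hs) r
    ... | inj₁ r′ with E⁼-inComponent f r′
    ...   | c , c≼ , p , q = c , here c≼ , p , q
    E⁼-fold-∪ f (h ∷ hs) r | inj₂ r′ with E⁼-fold-∪ h hs r′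
    ...   | c , c≼ , p , q = c , there c≼ , p , q

    E⁼-fold-product : ∀ {o} → IsProduct o → ∀ f fs {u v : Vtx {A}} →
      E⁼ (fold o ⟦ f ⟧ fs) u v → InComponentwise o (f ∷ fs) u v
    E⁼-fold-product π f [] r with E⁼-inComponent f r
    ... | c , c≼ , p , q = c ∷ [] , c≼ ∷ [] , p , q
    E⁼-fold-product π f (h ∷ hs) r with E⁼-product π ⟦ f ⟧ (fold _ ⟦ h ⟧ hs) r
    ... | concat r₁ r₂ with E⁼-inComponent f r₁ | E⁼-fold-product π h hs r₂
    ...   | c , c≼ , p₁ , p₂ | c′ ∷ cs , pw , q₁ , q₂ =
      c ∷ c′ ∷ cs , c≼ ∷ pw , V-product π p₁ q₁ , V-product π p₂ q₂

lemma2p9 : {A : Set} (m : ℕ) (Gs : Fin m → Graph A) →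
    (∀ i → WellFormed (Gs i)) →
    (f : Formula m) (u v : Vtx {A}) →
    E (Semantics.⟦_⟧ Gs f) u v →
    Σ (Formula m) λ c → (c ≼ f) × V (Semantics.⟦_⟧ Gs c) u × V (Semantics.⟦_⟧ Gs c) v
lemma2p9 m Gs wf f u v e = E⁼-inComponent Gs wf f (edge e)
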